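{- Let $P$ be a p-string, $x$ a prefix of $P$, $y$ a p-string with $x\equiv y$, and $a,b\in\Sigma\cup\Pi$. Then $xa\equiv yb$ if and only if one of the following holds: (1) $a\in\Sigma$ and $a=b$; (2) $a\in\Pi$, $\mathrm{first}_P(a)\ge|x|$, $b\in\Pi$ and $\mathrm{count}_y(b)=0$; (3) $a\in\Pi$, $\mathrm{first}_P(a)<|x|$ and $y[\mathrm{first}_P(a)]=b$. Here $\mathrm{first}_P:\Pi\to\mathbb{N}$ is given by $\mathrm{first}_P(c)=\min\{i<|P| : P[i]=c\}$ if $c\in\Pi_P$ and $\mathrm{first}_P(c)=|P|$ if $c\in\Pi\setminus\Pi_P$, and $\mathrm{count}_y(c)=|\{i<|y| : y[i]=c\}|$.
   Context: Let $\Sigma$ and $\Pi$ be disjoint alphabets; a p-string is a string over $\Sigma\cup\Pi$, indexed from 0. A permutation $f$ of $\Pi$ acts on p-strings letterwise, fixing letters of $\Sigma$; $x\equiv y$ iff $f(x)=y$ for some permutation $f$ of $\Pi$. $\Pi_P$ is the set of parameter characters occurring in $P$; $xa$ denotes concatenation. -}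

module Defs where

open import Data.Nat using (ℕ; zero; suc)
open import Data.List using (List; []; _∷_; map; length)
open import Data.Sum using (_⊎_; inj₁; inj₂)
open import Data.Product using (∃)
open import Function.Bundles using (_↔_; Inverse)
open import Relation.Binary.Definitions using (DecidableEquality)
open import Relation.Binary.PropositionalEquality using (_≡_)
open import Relation.Nullary using (yes; no)

module _ (Σ Π : Set) where

  -- Letters of Σ ∪ Π; Σ and Π are disjoint by construction (tagged union).
  Letter : Set
  Letter = Σ ⊎ Π

  -- p-strings, indexed from 0
  PString : Set
  PString = List Letter

module _ {Σ Π : Set} where

  actL : (Π ↔ Π) → Letter Σ Π → Letter Σ Π
  actL f (inj₁ s) = inj₁ s
  actL f (inj₂ p) = inj₂ (Inverse.to f p)

  act : (Π ↔ Π) → PString Σ Π → PString Σ Π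
  act f = map (actL f)

  _≈p_ : PString Σ Π → PString Σ Π → Set
  x ≈p y = ∃ λ (f : Π ↔ Π) → act f x ≡ y

  IsPrefix : PString Σ Π → PString Σ Π → Set
  IsPrefix x P = ∃ λ z → Data.List._++_ x z ≡ P

module _ {Σ Π : Set} (_≟Σ_ : DecidableEquality Σ) (_≟Π_ : DecidableEquality Π) where

  first : PString Σ Π → Π → ℕ
  first [] c = zero
  first (inj₁ s ∷ P) c = suc (first P c)
  first (inj₂ p ∷ P) c with p ≟Π c
  ... | yes _ = zero
  ... | no  _ = suc (first P c)

  count : PString Σ Π → Π → ℕ
  count [] c = zero
  count (inj₁ s ∷ y) c = count y c
  count (inj₂ p ∷ y) c with p ≟Π c
  ... | yes _ = suc (count y c)
  ... | no  _ = count y c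

{-# OPTIONS --safe #-}
module Submission where

open import Defs
open import Data.Nat using (ℕ; _<_; _≥_; suc; s≤s)
open import Data.Nat.Properties using (_<?_; ≮⇒≥)
open import Data.List using (List; []; _∷_; _++_; length; lookup; map)
open import Data.List.Properties using (map-++; map-∘; map-cong; length-map; ∷ʳ-injective)
open import Data.Fin using (fromℕ<)
open import Data.Sum using (_⊎_; inj₁; inj₂)
open import Data.Product using (_×_; _,_; ∃; Σ-syntax)
open import Data.Empty using (⊥-elim)
open import Function.Bundles using (_⇔_; _↔_; Inverse; Injection; mk↔ₛ′; mk⇔)
open import Function.Construct.Composition using (_↔-∘_)
open import Function.Properties.Inverse using (↔⇒↣)
open import Relation.Binary.Definitions using (DecidableEquality)
open import Relation.Binary.PropositionalEquality
  using (_≡_; _≢_; refl; sym; trans; cong; cong₂; subst; module ≡-Reasoning)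
open import Relation.Nullary using (yes; no)

-- Write y = f(x). If a is a parameter that already occurs in x, its first occurrence
-- fixes its image, which must be y[first_P(a)]. Otherwise a is fresh for x, so its
-- image f(a) is fresh for y; conversely any b fresh for y can be reached by
-- post-composing f with the transposition (f(a) b), which fixes every letter of y.

module Transposition {A : Set} (_≟_ : DecidableEquality A) where

  swap : A → A → A → A
  swap u v w with w ≟ u
  ... | yes _ = v
  ... | no _ with w ≟ v
  ...   | yes _ = u
  ...   | no _ = w

  swap-left : ∀ u v → swap u v u ≡ v
  swap-left u v with u ≟ u
  ... | yes _ = refl
  ... | no u≢u = ⊥-elim (u≢u refl)

  swap-right : ∀ u v → swap u v v ≡ u
  swap-right u v with v ≟ u
  ... | yes v≡u = v≡u
  ... | no _ with v ≟ v
  ...   | yes _ = refl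
  ...   | no v≢v = ⊥-elim (v≢v refl)

  swap-other : ∀ u v w → w ≢ u → w ≢ v → swap u v w ≡ w
  swap-other u v w w≢u w≢v with w ≟ u
  ... | yes w≡u = ⊥-elim (w≢u w≡u)
  ... | no _ with w ≟ v
  ...   | yes w≡v = ⊥-elim (w≢v w≡v)
  ...   | no _ = refl

  swap-involutive : ∀ u v w → swap u v (swap u v w) ≡ w
  swap-involutive u v w with w ≟ u
  ... | yes refl = swap-right w v
  ... | no w≢u with w ≟ v
  ...   | yes refl = swap-left u w
  ...   | no w≢v = swap-other u v w w≢u w≢v

  transpose : A → A → A ↔ A
  transpose u v = mk↔ₛ′ (swap u v) (swap u v) (swap-involutive u v) (swap-involutive u v)

lookup-map-fromℕ< : {A B : Set} (f : A → B) (xs : List A) {n : ℕ}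
                    (n<∣xs∣ : n < length xs) (n<∣fxs∣ : n < length (map f xs)) →
                    lookup (map f xs) (fromℕ< n<∣fxs∣) ≡ f (lookup xs (fromℕ< n<∣xs∣))
lookup-map-fromℕ< f (x ∷ xs) {0}     _              _               = refl
lookup-map-fromℕ< f (x ∷ xs) {suc n} (s≤s n<∣xs∣) (s≤s n<∣fxs∣) =
  lookup-map-fromℕ< f xs n<∣xs∣ n<∣fxs∣

module _ {S Π : Set} (_≟S_ : DecidableEquality S) (_≟Π_ : DecidableEquality Π) where

  open Transposition _≟Π_

  private
    first′ : PString S Π → Π → ℕ
    first′ = first _≟S_ _≟Π_

    count′ : PString S Π → Π → ℕ
    count′ = count _≟S_ _≟Π_

  act-∘ : (g f : Π ↔ Π) (x : PString S Π) → act (g ↔-∘ f) x ≡ act g (act f x)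
  act-∘ g f x = trans (map-cong actL-∘ x) (map-∘ x)
    where
    actL-∘ : ∀ l → actL (g ↔-∘ f) l ≡ actL g (actL f l)
    actL-∘ (inj₁ s) = refl
    actL-∘ (inj₂ p) = refl

  ≈p-snoc : (x y : PString S Π) (a b : Letter S Π) →
            (x ++ a ∷ []) ≈p (y ++ b ∷ []) → ∃ λ g → act g x ≡ y × actL g a ≡ b
  ≈p-snoc x y a b (g , gxa≡yb) = g , ∷ʳ-injective (act g x) y (trans (sym (map-++ (actL g) x _)) gxa≡yb)

  snoc-≈p : (x y : PString S Π) (a b : Letter S Π) →
            (∃ λ g → act g x ≡ y × actL g a ≡ b) → (x ++ a ∷ []) ≈p (y ++ b ∷ [])
  snoc-≈p x y a b (g , refl , refl) = g , map-++ (actL g) x _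

  count-act : (f : Π ↔ Π) (x : PString S Π) (c : Π) → count′ (act f x) (Inverse.to f c) ≡ count′ x c
  count-act f [] c = refl
  count-act f (inj₁ s ∷ x) c = count-act f x c
  count-act f (inj₂ p ∷ x) c with p ≟Π c | Inverse.to f p ≟Π Inverse.to f c
  ... | yes _   | yes _     = cong suc (count-act f x c)
  ... | yes p≡c | no fp≢fc  = ⊥-elim (fp≢fc (cong (Inverse.to f) p≡c))
  ... | no p≢c  | yes fp≡fc = ⊥-elim (p≢c (Injection.injective (↔⇒↣ f) fp≡fc))
  ... | no _    | no _      = count-act f x c

  count-∷≡0 : (p : Π) (y : PString S Π) (u : Π) → count′ (inj₂ p ∷ y) u ≡ 0 → p ≢ u × count′ y u ≡ 0
  count-∷≡0 p y u py-u with p ≟Π u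
  count-∷≡0 p y u () | yes _
  ... | no p≢u = p≢u , py-u

  act-transpose-fresh : (y : PString S Π) (u v : Π) → count′ y u ≡ 0 → count′ y v ≡ 0 →
                        act (transpose u v) y ≡ y
  act-transpose-fresh [] u v _ _ = refl
  act-transpose-fresh (inj₁ s ∷ y) u v y-u y-v = cong (inj₁ s ∷_) (act-transpose-fresh y u v y-u y-v)
  act-transpose-fresh (inj₂ p ∷ y) u v py-u py-v
    with p≢u , y-u ← count-∷≡0 p y u py-u | p≢v , y-v ← count-∷≡0 p y v py-v =
    cong₂ _∷_ (cong inj₂ (swap-other u v p p≢u p≢v)) (act-transpose-fresh y u v y-u y-v)

  lookup-first : (x z : PString S Π) (c : Π) (h : first′ (x ++ z) c < length x) →
                 lookup x (fromℕ< h) ≡ inj₂ c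
  lookup-first (inj₁ s ∷ x) z c (s≤s h) = lookup-first x z c h
  lookup-first (inj₂ p ∷ x) z c h with p ≟Π c
  ... | yes p≡c = cong inj₂ p≡c
  lookup-first (inj₂ p ∷ x) z c (s≤s h) | no _ = lookup-first x z c h

  first-≥⇒count≡0 : (x z : PString S Π) (c : Π) → first′ (x ++ z) c ≥ length x → count′ x c ≡ 0
  first-≥⇒count≡0 [] z c _ = refl
  first-≥⇒count≡0 (inj₁ s ∷ x) z c (s≤s h) = first-≥⇒count≡0 x z c h
  first-≥⇒count≡0 (inj₂ p ∷ x) z c h with p ≟Π c
  first-≥⇒count≡0 (inj₂ p ∷ x) z c () | yes _
  first-≥⇒count≡0 (inj₂ p ∷ x) z c (s≤s h) | no _ = first-≥⇒count≡0 x z c h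

  lookup-act-first : (f : Π ↔ Π) (x z : PString S Π) (c : Π)
                     (h : first′ (x ++ z) c < length x) (h′ : first′ (x ++ z) c < length (act f x)) →
                     lookup (act f x) (fromℕ< h′) ≡ inj₂ (Inverse.to f c)
  lookup-act-first f x z c h h′ =
    trans (lookup-map-fromℕ< (actL f) x h h′) (cong (actL f) (lookup-first x z c h))

  ExtensionCase : (P x y : PString S Π) (a b : Letter S Π) → Set
  ExtensionCase P x y a b =
    (∃ λ (s : S) → (a ≡ inj₁ s) × (b ≡ inj₁ s))
    ⊎ (∃ λ (c : Π) → ∃ λ (d : Π) →
         (a ≡ inj₂ c) × (first′ P c ≥ length x) × (b ≡ inj₂ d) × (count′ y d ≡ 0))
    ⊎ (∃ λ (c : Π) → (a ≡ inj₂ c) × (first′ P c < length x)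
         × (Σ[ h ∈ first′ P c < length y ] (lookup y (fromℕ< h) ≡ b)))

  extensionCase-act : (g : Π ↔ Π) (x z : PString S Π) (a : Letter S Π) →
                      ExtensionCase (x ++ z) x (act g x) a (actL g a)
  extensionCase-act g x z (inj₁ s) = inj₁ (s , refl , refl)
  extensionCase-act g x z (inj₂ c) with first′ (x ++ z) c <? length x
  ... | yes lt = inj₂ (inj₂ (c , refl , lt , h , lookup-act-first g x z c lt h))
    where h = subst (first′ (x ++ z) c <_) (sym (length-map (actL g) x)) lt
  ... | no ¬lt = inj₂ (inj₁ (c , Inverse.to g c , refl , ge , refl ,
                   trans (count-act g x c) (first-≥⇒count≡0 x z c ge)))
    where ge = ≮⇒≥ ¬lt

  extensionCase-permutation : (f : Π ↔ Π) (x z : PString S Π) (a b : Letter S Π) →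
                              ExtensionCase (x ++ z) x (act f x) a b →
                              ∃ λ g → act g x ≡ act f x × actL g a ≡ b
  extensionCase-permutation f x z a b (inj₁ (s , refl , refl)) = f , refl , refl
  extensionCase-permutation f x z a b (inj₂ (inj₂ (c , refl , lt , h , fx[i]≡b))) =
    f , refl , trans (sym (lookup-act-first f x z c lt h)) fx[i]≡b
  extensionCase-permutation f x z a b (inj₂ (inj₁ (c , d , refl , ge , refl , fx-d))) =
    transpose fc d ↔-∘ f , fixes-x , cong inj₂ (swap-left fc d)
    where
    open ≡-Reasoning
    fc = Inverse.to f c
    fixes-x : act (transpose fc d ↔-∘ f) x ≡ act f x
    fixes-x = begin
      act (transpose fc d ↔-∘ f) x  ≡⟨ act-∘ (transpose fc d) f x ⟩
      act (transpose fc d) (act f x) ≡⟨ act-transpose-fresh (act f x) fc d fx-fc fx-d ⟩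
      act f x                        ∎
      where fx-fc = trans (count-act f x c) (first-≥⇒count≡0 x z c ge)

  extensionCase-necessary : (x z y : PString S Π) (a b : Letter S Π) →
                            (x ++ a ∷ []) ≈p (y ++ b ∷ []) → ExtensionCase (x ++ z) x y a b
  extensionCase-necessary x z y a b xa≈yb with ≈p-snoc x y a b xa≈yb
  ... | g , refl , refl = extensionCase-act g x z a

  extensionCase-sufficient : (x z y : PString S Π) (a b : Letter S Π) → x ≈p y →
                             ExtensionCase (x ++ z) x y a b → (x ++ a ∷ []) ≈p (y ++ b ∷ [])
  extensionCase-sufficient x z y a b (f , refl) case =
    snoc-≈p x (act f x) a b (extensionCase-permutation f x z a b case)

lemma11 : {S Π : Set} (_≟S_ : DecidableEquality S) (_≟Π_ : DecidableEquality Π)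
          (P x y : PString S Π) (a b : Letter S Π) →
          IsPrefix x P → x ≈p y →
          ((x ++ (a ∷ [])) ≈p (y ++ (b ∷ [])))
            ⇔ ((∃ λ (s : S) → (a ≡ inj₁ s) × (b ≡ inj₁ s))
               ⊎ (∃ λ (c : Π) → ∃ λ (d : Π) →
                    (a ≡ inj₂ c) × (first _≟S_ _≟Π_ P c ≥ length x)
                    × (b ≡ inj₂ d) × (count _≟S_ _≟Π_ y d ≡ 0))
               ⊎ (∃ λ (c : Π) → (a ≡ inj₂ c) × (first _≟S_ _≟Π_ P c < length x)
                    × (Σ[ h ∈ first _≟S_ _≟Π_ P c < length y ]
                         (lookup y (fromℕ< h) ≡ b))))
lemma11 _≟S_ _≟Π_ P x y a b (z , refl) x≈y =
  mk⇔ (extensionCase-necessary _≟S_ _≟Π_ x z y a b) (extensionCase-sufficient _≟S_ _≟Π_ x z y a b x≈y)
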